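{- Every oriented graph $D$ with $\delta^+(D) \geq 2$ contains a subdivision of $C(2,2)$.
   Context: Digraphs are finite, without loops or parallel arcs. An oriented graph is a digraph with no digon (no pair of opposite arcs $uv, vu$), i.e. of digirth at least $3$. $\delta^+(D)$ is the minimum out-degree. $C(2,2)$ is the union of two internally vertex-disjoint directed paths of length $2$ from a vertex $x$ to a vertex $y$. A subdivision of a digraph $F$ is obtained by replacing each arc $uv$ by a directed path from $u$ to $v$; $D$ contains a subdivision of $F$ if some subdigraph of $D$ is one. -}

module Defs where

open import Data.Nat using (ℕ; _≤_)
open import Data.Fin using (Fin; zero; suc)
open import Data.Bool using (Bool; true; false)
open import Data.List using (List; []; _∷_; _++_; length; filterᵇ; allFin)
open import Data.List.Relation.Unary.Linked using (Linked)
open import Data.List.Relation.Unary.Unique.Propositional using (Unique)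
open import Data.List.Membership.Propositional using (_∈_; _∉_)
open import Data.Product using (_×_)
open import Data.Sum using (_⊎_)
open import Relation.Binary.PropositionalEquality using (_≡_; _≢_)
open import Relation.Nullary using (¬_)
open import Function.Definitions using (Injective)

record Digraph (n : ℕ) : Set where
  field
    arc      : Fin n → Fin n → Bool
    loopless : ∀ v → arc v v ≡ false

open Digraph public

Arc : ∀ {n} → Digraph n → Fin n → Fin n → Set
Arc D u v = arc D u v ≡ true

Oriented : ∀ {n} → Digraph n → Set
Oriented D = ∀ u v → Arc D u v → ¬ Arc D v u

outDegree : ∀ {n} → Digraph n → Fin n → ℕ
outDegree {n} D u = length (filterᵇ (arc D u) (allFin n))

MinOutDegreeAtLeast : ∀ {n} → ℕ → Digraph n → Set
MinOutDegreeAtLeast k D = ∀ u → k ≤ outDegree D u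

IsPath : ∀ {n} → Digraph n → Fin n → List (Fin n) → Fin n → Set
IsPath D u mids v =
  Linked (Arc D) (u ∷ mids ++ v ∷ []) × Unique (u ∷ mids ++ v ∷ [])

record SubdivisionIn {k n : ℕ} (F : Digraph k) (D : Digraph n) : Set where
  field
    branch      : Fin k → Fin n
    branch-inj  : Injective _≡_ _≡_ branch
    route       : ∀ i j → Arc F i j → List (Fin n)
    route-path  : ∀ i j (e : Arc F i j) → IsPath D (branch i) (route i j e) (branch j)
    route-avoid : ∀ i j (e : Arc F i j) w → w ∈ route i j e → ∀ l → w ≢ branch l
    route-disj  : ∀ i j i' j' (e : Arc F i j) (e' : Arc F i' j') →
                  (i ≢ i' ⊎ j ≢ j') →
                  ∀ w → w ∈ route i j e → w ∉ route i' j' e'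

ContainsSubdivision : ∀ {k n} → Digraph n → Digraph k → Set
ContainsSubdivision D F = SubdivisionIn F D

-- C(2,2): vertices x = 0, a = 1, b = 2, y = 3; arcs xa, ay, xb, by.
C22-arc : Fin 4 → Fin 4 → Bool
C22-arc zero (suc zero) = true
C22-arc zero (suc (suc zero)) = true
C22-arc (suc zero) (suc (suc (suc zero))) = true
C22-arc (suc (suc zero)) (suc (suc (suc zero))) = true
C22-arc _ _ = false

C22-loopless : ∀ v → C22-arc v v ≡ false
C22-loopless zero = Relation.Binary.PropositionalEquality.refl
C22-loopless (suc zero) = Relation.Binary.PropositionalEquality.refl
C22-loopless (suc (suc zero)) = Relation.Binary.PropositionalEquality.refl
C22-loopless (suc (suc (suc zero))) = Relation.Binary.PropositionalEquality.refl

C22 : Digraph 4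
C22 = record { arc = C22-arc ; loopless = C22-loopless }

module Submission where

-- Give every vertex two out-neighbours, its children, and write Region x s for the
-- vertices reachable from x without passing through its child b = child s x.
--
-- If some y ≠ x lies in both regions of x, D contains a C(2,2): the path from x to y
-- avoiding the other child a runs through b and enters Region x s, say at w; its part
-- up to w and a path from x to w inside Region x s are internally disjoint.
--
-- Let R be the set reachable from a vertex reaching as few vertices as possible; R is
-- closed under children and strongly connected. Take x ∈ R and s minimising
-- |Region x s|, and let a be the other child of x. Unless b lies in both regions of a
-- (a C(2,2) as above), some region of a misses b and is then contained in
-- Region x s; by minimality it must contain x, so it is the region of a avoiding b,
-- and it is minimal again. Doing this twice gives x → a → a′ with b a child of a and
-- of a′, x in the region of a avoiding b and a in the region of a′ avoiding b.
-- Finally a path from b back to x enters Region x s at some w, and w is a common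
-- vertex of both regions of a (if w = x), of a′ (if w = a) or of x (otherwise).

open import Defs
open import Data.Bool using (Bool; true; false; not)
open import Data.Bool.Properties using (T-≡)
open import Data.Empty using (⊥; ⊥-elim)
open import Data.Fin using (Fin; _≟_)
open import Data.Fin.Patterns using (0F; 1F; 2F; 3F)
open import Data.Fin.Subset
  using (Subset; _∈_; _∉_; _⊆_; _⊂_; _⊃_; _∪_; _∩_; ∁; ⁅_⁆; ∣_∣) renaming (⊥ to ∅)
open import Data.Fin.Subset.Properties
  using (_∈?_; ∉⊥; x∈⁅x⁆; x∈⁅y⁆⇒x≡y; x≢y⇒x∉⁅y⁆; x∉⁅y⁆⇒x≢y; p⊆p∪q; q⊆p∪q; x∈p∪q⁺; x∈p∪q⁻;
         x∈p∩q⁺; x∈p∩q⁻; p∩q⊆p; x∉p⇒x∈∁p; x∈∁p⇒x∉p; ⊆-reflexive; ∪-assoc; ∪-comm;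
         p⊆q⇒∣p∣≤∣q∣; p⊂q⇒∣p∣<∣q∣)
open import Data.Fin.Subset.Induction using (⊃-wellFounded; Acc; acc)
open import Data.List using (List; []; _∷_; _++_; length; filter; filterᵇ; allFin; cartesianProduct)
open import Data.List.Extrema.Nat using (argmin; argmin-sel; f[argmin]≤f[xs])
open import Data.List.Membership.Propositional using () renaming (_∈_ to _∈ₗ_; _∉_ to _∉ₗ_)
open import Data.List.Membership.Propositional.Properties
  using (∈-filter⁺; ∈-filter⁻; ∈-cartesianProduct⁺; ∈-cartesianProduct⁻; ∈-allFin; ∈-++⁺ˡ; ∈-++⁺ʳ)
open import Data.List.Relation.Unary.All as All using (All; []; _∷_)
open import Data.List.Relation.Unary.AllPairs using ([]; _∷_)
open import Data.List.Relation.Unary.Any using (here; there)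
open import Data.List.Relation.Unary.Linked using (Linked; [-]; _∷_)
open import Data.List.Relation.Unary.Unique.Propositional using (Unique)
open import Data.List.Relation.Unary.Unique.Propositional.Properties using (filter⁺; allFin⁺)
open import Data.Nat using (ℕ; _≤_; s≤s)
open import Data.Nat.Properties using (≤-trans; <⇒≱)
open import Data.Product using (_×_; _,_; proj₁; proj₂; ∃₂; ∃-syntax; Σ-syntax)
open import Data.Sum using (_⊎_; inj₁; inj₂; [_,_]′; map₁)
open import Data.Vec using (lookup; tabulate; []; _∷_)
open import Data.Vec.Properties using (lookup∘tabulate; lookup⇒[]=; []=⇒lookup)
open import Data.Vec.Relation.Unary.All using ([]; _∷_)
open import Data.Vec.Relation.Unary.AllPairs using ([]; _∷_)
import Data.Vec.Relation.Unary.Unique.Propositional as Vec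
open import Data.Vec.Relation.Unary.Unique.Propositional.Properties using (lookup-injective)
open import Function using (_∘_; id; Equivalence)
open import Relation.Binary.PropositionalEquality
  using (_≡_; _≢_; refl; sym; trans; cong; subst; ≢-sym)
open import Relation.Nullary using (Dec; yes; no; does)
open import Relation.Nullary.Decidable using (dec-true; T?)
open import Relation.Unary using (Pred; Decidable)

private
  variable
    n : ℕ

module _ {A : Set} where

  two-distinct : ∀ {xs : List A} → Unique xs → 2 ≤ length xs → ∃₂ λ a b → a ∈ₗ xs × b ∈ₗ xs × a ≢ b
  two-distinct {[]}        _                ()
  two-distinct {_ ∷ []}    _                (s≤s ())
  two-distinct {_ ∷ _ ∷ _} ((a≢b ∷ _) ∷ _) _ = _ , _ , here refl , there (here refl) , a≢b

  ∈-init⇒≢-last : ∀ {xs : List A} {x y} → Unique (xs ++ y ∷ []) → x ∈ₗ xs → x ≢ y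
  ∈-init⇒≢-last {_ ∷ xs} (x≢ ∷ _) (here refl) = All.lookup x≢ (∈-++⁺ʳ xs (here refl))
  ∈-init⇒≢-last {_ ∷ _}  (_ ∷ u)  (there x∈) = ∈-init⇒≢-last u x∈

  ends-≢ : ∀ {x a : A} {P} {w} → Unique (x ∷ a ∷ P ++ w ∷ []) → x ≢ a × x ≢ w × a ≢ w
  ends-≢ {P = P} ((x≢a ∷ x≢) ∷ a≢ ∷ _) =
    x≢a , All.lookup x≢ (∈-++⁺ʳ P (here refl)) , All.lookup a≢ (∈-++⁺ʳ P (here refl))

  interior-≢ : ∀ {x a : A} {P} {w v} → Unique (x ∷ a ∷ P ++ w ∷ []) → v ∈ₗ P → v ≢ x × v ≢ a × v ≢ w
  interior-≢ ((_ ∷ x≢) ∷ a≢ ∷ u) v∈ =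
    ≢-sym (All.lookup x≢ (∈-++⁺ˡ v∈)) , ≢-sym (All.lookup a≢ (∈-++⁺ˡ v∈)) , ∈-init⇒≢-last u v∈

  ∃-minimal-∈ : (f : A → ℕ) {x : A} {xs : List A} → x ∈ₗ xs →
                ∃[ m ] m ∈ₗ xs × (∀ {y} → y ∈ₗ xs → f m ≤ f y)
  ∃-minimal-∈ f {x} {xs} x∈xs =
    argmin f x xs ,
    [ (λ argmin≡x → subst (_∈ₗ xs) (sym argmin≡x) x∈xs) , id ]′ (argmin-sel f x xs) ,
    All.lookup (f[argmin]≤f[xs] x xs)

module _ {p q : Subset n} {x : Fin n} where

  x∉p∪q⁺ : x ∉ p → x ∉ q → x ∉ p ∪ q
  x∉p∪q⁺ x∉p x∉q = [ x∉p , x∉q ]′ ∘ x∈p∪q⁻ p q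

  x∉p∪q⁻ˡ : x ∉ p ∪ q → x ∉ p
  x∉p∪q⁻ˡ x∉p∪q = x∉p∪q ∘ p⊆p∪q q

  x∉p∪q⁻ʳ : x ∉ p ∪ q → x ∉ q
  x∉p∪q⁻ʳ x∉p∪q = x∉p∪q ∘ q⊆p∪q p q

⁅x⁆∪⁅y⁆⊆p : ∀ {p : Subset n} {x y} → x ∈ p → y ∈ p → ⁅ x ⁆ ∪ ⁅ y ⁆ ⊆ p
⁅x⁆∪⁅y⁆⊆p {x = x} {y} x∈p y∈p v∈ =
  [ (λ v∈⁅x⁆ → subst (_∈ _) (sym (x∈⁅y⁆⇒x≡y x v∈⁅x⁆)) x∈p)
  , (λ v∈⁅y⁆ → subst (_∈ _) (sym (x∈⁅y⁆⇒x≡y y v∈⁅y⁆)) y∈p) ]′ (x∈p∪q⁻ _ _ v∈)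

p⊆q∧∣q∣≤∣p∣⇒q⊆p : ∀ {p q : Subset n} → p ⊆ q → ∣ q ∣ ≤ ∣ p ∣ → q ⊆ p
p⊆q∧∣q∣≤∣p∣⇒q⊆p {p = p} p⊆q ∣q∣≤∣p∣ {x} x∈q with x ∈? p
... | yes x∈p = x∈p
... | no  x∉p = ⊥-elim (<⇒≱ (p⊂q⇒∣p∣<∣q∣ (p⊆q , x , x∈q , x∉p)) ∣q∣≤∣p∣)

module _ {ℓ} {P : Pred (Fin n) ℓ} where

  ⟦_⟧ : Decidable P → Subset n
  ⟦ P? ⟧ = tabulate (does ∘ P?)

  ∈⟦⟧⁺ : ∀ (P? : Decidable P) {x} → P x → x ∈ ⟦ P? ⟧
  ∈⟦⟧⁺ P? {x} Px = lookup⇒[]= x _ (trans (lookup∘tabulate _ x) (dec-true (P? x) Px))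

  ∈⟦⟧⁻ : ∀ (P? : Decidable P) {x} → x ∈ ⟦ P? ⟧ → P x
  ∈⟦⟧⁻ P? {x} x∈ with P? x | trans (sym (lookup∘tabulate (does ∘ P?) x)) ([]=⇒lookup x∈)
  ... | yes Px | _ = Px

data C22-Arc : Fin 4 → Fin 4 → Set where
  x⟶a : C22-Arc 0F 1F
  x⟶b : C22-Arc 0F 2F
  a⟶y : C22-Arc 1F 3F
  b⟶y : C22-Arc 2F 3F

C22-arc-view : ∀ i j → Arc C22 i j → C22-Arc i j
C22-arc-view 0F 1F _ = x⟶a
C22-arc-view 0F 2F _ = x⟶b
C22-arc-view 1F 3F _ = a⟶y
C22-arc-view 2F 3F _ = b⟶y
C22-arc-view 0F 0F ()
C22-arc-view 0F 3F ()
C22-arc-view 1F 0F ()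
C22-arc-view 1F 1F ()
C22-arc-view 1F 2F ()
C22-arc-view 2F 0F ()
C22-arc-view 2F 1F ()
C22-arc-view 2F 2F ()
C22-arc-view 3F _  ()

module _ {D : Digraph n} where

  two-out-neighbours : ∀ {u} → 2 ≤ outDegree D u →
                       Σ[ f ∈ (Bool → Fin n) ] (∀ t → Arc D u (f t)) × f true ≢ f false
  two-out-neighbours {u} 2≤deg with two-distinct (filter⁺ (T? ∘ arc D u) (allFin⁺ n)) 2≤deg
  ... | a , b , a∈ , b∈ , a≢b =
    (λ { true → a ; false → b }) , (λ { true → arc-to a∈ ; false → arc-to b∈ }) , a≢b
    where
    arc-to : ∀ {v} → v ∈ₗ filterᵇ (arc D u) (allFin n) → Arc D u v
    arc-to v∈ = Equivalence.to T-≡ (proj₂ (∈-filter⁻ (T? ∘ arc D u) {xs = allFin n} v∈))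

  disjoint-paths⇒C22 : ∀ {x w P Q} → IsPath D x P w → IsPath D x Q w → P ≢ [] → Q ≢ [] →
                       (∀ {v} → v ∈ₗ P → v ∉ₗ Q) → ContainsSubdivision D C22
  disjoint-paths⇒C22 {P = []} _ _ P≢[] _ _ = ⊥-elim (P≢[] refl)
  disjoint-paths⇒C22 {Q = []} _ _ _ Q≢[] _ = ⊥-elim (Q≢[] refl)
  disjoint-paths⇒C22 {x} {w} {a ∷ P} {b ∷ Q}
                     (xa ∷ a↝w , xaPw@(_ ∷ aPw)) (xb ∷ b↝w , xbQw@(_ ∷ bQw)) _ _ P∩Q =
    record
      { branch      = branch
      ; branch-inj  = λ {i} {j} → lookup-injective distinct i j
      ; route       = λ i j e → route (C22-arc-view i j e)
      ; route-path  = λ i j e → route-path (C22-arc-view i j e)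
      ; route-avoid = λ i j e → route-avoid (C22-arc-view i j e)
      ; route-disj  = λ i j i' j' e e' → route-disj (C22-arc-view i j e) (C22-arc-view i' j' e')
      }
    where
    branch : Fin 4 → Fin n
    branch = lookup (x ∷ a ∷ b ∷ w ∷ [])

    a≢b : a ≢ b
    a≢b a≡b = P∩Q (here refl) (here a≡b)

    distinct : Vec.Unique (x ∷ a ∷ b ∷ w ∷ [])
    distinct =
      let x≢a , x≢w , a≢w = ends-≢ {P = P} xaPw
          x≢b , _   , b≢w = ends-≢ {P = Q} xbQw
      in  (x≢a ∷ x≢b ∷ x≢w ∷ []) ∷ (a≢b ∷ a≢w ∷ []) ∷ (b≢w ∷ []) ∷ [] ∷ []

    route : ∀ {i j} → C22-Arc i j → List (Fin n)
    route x⟶a = []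
    route x⟶b = []
    route a⟶y = P
    route b⟶y = Q

    route-path : ∀ {i j} (e : C22-Arc i j) → IsPath D (branch i) (route e) (branch j)
    route-path x⟶a = xa ∷ [-] , (let x≢a , _ = ends-≢ {P = P} xaPw in (x≢a ∷ []) ∷ [] ∷ [])
    route-path x⟶b = xb ∷ [-] , (let x≢b , _ = ends-≢ {P = Q} xbQw in (x≢b ∷ []) ∷ [] ∷ [])
    route-path a⟶y = a↝w , aPw
    route-path b⟶y = b↝w , bQw

    avoid : ∀ {v} → v ≢ x → v ≢ a → v ≢ b → v ≢ w → ∀ l → v ≢ branch l
    avoid v≢x _   _   _   0F = v≢x
    avoid _   v≢a _   _   1F = v≢a
    avoid _   _   v≢b _   2F = v≢b
    avoid _   _   _   v≢w 3F = v≢w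

    route-avoid : ∀ {i j} (e : C22-Arc i j) v → v ∈ₗ route e → ∀ l → v ≢ branch l
    route-avoid a⟶y v v∈P =
      let v≢x , v≢a , v≢w = interior-≢ {P = P} {w} xaPw v∈P
      in  avoid v≢x v≢a (λ v≡b → P∩Q (there v∈P) (here v≡b)) v≢w
    route-avoid b⟶y v v∈Q =
      let v≢x , v≢b , v≢w = interior-≢ {P = Q} {w} xbQw v∈Q
      in  avoid v≢x (λ { refl → P∩Q (here refl) (there v∈Q) }) v≢b v≢w

    irreflexive : ∀ {i j : Fin 4} → i ≢ i ⊎ j ≢ j → ⊥
    irreflexive = [ (λ i≢i → i≢i refl) , (λ j≢j → j≢j refl) ]′

    route-disj : ∀ {i j i' j'} (e : C22-Arc i j) (e' : C22-Arc i' j') → i ≢ i' ⊎ j ≢ j' →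
                 ∀ v → v ∈ₗ route e → v ∉ₗ route e'
    route-disj a⟶y b⟶y _ _ v∈P v∈Q = P∩Q (there v∈P) (there v∈Q)
    route-disj b⟶y a⟶y _ _ v∈Q v∈P = P∩Q (there v∈P) (there v∈Q)
    route-disj a⟶y a⟶y different = ⊥-elim (irreflexive different)
    route-disj b⟶y b⟶y different = ⊥-elim (irreflexive different)
    route-disj a⟶y x⟶a _ _ _ ()
    route-disj a⟶y x⟶b _ _ _ ()
    route-disj b⟶y x⟶a _ _ _ ()
    route-disj b⟶y x⟶b _ _ _ ()

module TwoOut (D : Digraph n) (oriented : Oriented D)
  (child : Bool → Fin n → Fin n)
  (child-arc : ∀ t v → Arc D v (child t v))
  (children-≢ : ∀ v → child true v ≢ child false v) where

  private
    variable
      B B' S : Subset n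
      c u v x y z : Fin n
      s s' t τ : Bool

  child≢sibling : ∀ t v → child t v ≢ child (not t) v
  child≢sibling true  v = children-≢ v
  child≢sibling false v = ≢-sym (children-≢ v)

  child-cases : ∀ ρ s → child ρ v ≡ child s v ⊎ child ρ v ≡ child (not s) v
  child-cases true  true  = inj₁ refl
  child-cases true  false = inj₂ refl
  child-cases false true  = inj₂ refl
  child-cases false false = inj₁ refl

  child≢self : ∀ t v → child t v ≢ v
  child≢self t v child≡v with () ← trans (sym (subst (Arc D v) child≡v (child-arc t v))) (loopless D v)

  grandchild≢self : ∀ t t' v → child t' (child t v) ≢ v
  grandchild≢self t t' v eq =
    oriented v (child t v) (child-arc t v) (subst (Arc D (child t v)) eq (child-arc t' (child t v)))

  -- Each visited vertex joins the avoided set, so these paths are simple.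
  data Path (B : Subset n) (c : Fin n) : Fin n → Set where
    done : c ∉ B → Path B c c
    via  : c ∉ B → ∀ t → Path (B ∪ ⁅ c ⁆) (child t c) v → Path B c v

  head∉ : Path B c v → c ∉ B
  head∉ (done c∉B)    = c∉B
  head∉ (via c∉B _ _) = c∉B

  last∉ : Path B c v → v ∉ B
  last∉ (done c∉B)  = c∉B
  last∉ (via _ _ p) = x∉p∪q⁻ˡ (last∉ p)

  trail : Path B c v → List (Fin n)
  trail (done _)            = []
  trail {c = c} (via _ _ p) = c ∷ trail p

  prefix : (p : Path B c v) → u ∈ₗ trail p → Path B c u
  prefix (via c∉B _ _) (here refl) = done c∉B
  prefix (via c∉B t p) (there u∈)  = via c∉B t (prefix p u∈)

  trail-∉ : (p : Path B c v) → u ∈ₗ trail p → u ∉ B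
  trail-∉ p u∈ = last∉ (prefix p u∈)

  trail-≢ : (p : Path B c v) → u ∈ₗ trail p → u ≢ v
  trail-≢ (via _ _ p) (here refl) refl = last∉ p (q⊆p∪q _ _ (x∈⁅x⁆ _))
  trail-≢ (via _ _ p) (there u∈)       = trail-≢ p u∈

  trail≢[] : c ≢ v → (p : Path B c v) → trail p ≢ []
  trail≢[] c≢c (done _)    _ = c≢c refl
  trail≢[] _   (via _ _ _) ()

  uncons : c ≢ v → Path B c v → ∃[ t ] Path (B ∪ ⁅ c ⁆) (child t c) v
  uncons c≢c (done _)    = ⊥-elim (c≢c refl)
  uncons _   (via _ t p) = t , p

  weaken : B' ⊆ B → Path B c v → Path B' c v
  weaken B'⊆B (done c∉B)    = done (c∉B ∘ B'⊆B)
  weaken B'⊆B (via c∉B t p) = via (c∉B ∘ B'⊆B) t (weaken (x∈p∪q⁺ ∘ map₁ B'⊆B ∘ x∈p∪q⁻ _ _) p)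

  extend : Path B c u → ∀ t → child t u ∉ B → Path B c (child t u)
  extend {c = c} (done c∉B) t w∉B =
    via c∉B t (done (x∉p∪q⁺ w∉B (x≢y⇒x∉⁅y⁆ (child≢self t c))))
  extend {c = c} {u} (via c∉B t' p) t w∉B with child t u ≟ c
  ... | yes w≡c = subst (Path _ c) (sym w≡c) (done c∉B)
  ... | no  w≢c = via c∉B t' (extend p t (x∉p∪q⁺ w∉B (x≢y⇒x∉⁅y⁆ w≢c)))

  Path-ind : ∀ {ℓ} (W : Pred (Fin n) ℓ) → (∀ {u} t → W u → child t u ∉ B → W (child t u)) →
             W c → Path B c v → W v
  Path-ind W closed Wc (done _)    = Wc
  Path-ind W closed Wc (via _ t p) =
    Path-ind W (λ t' Wu w∉ → closed t' Wu (x∉p∪q⁻ˡ w∉)) (closed t Wc (x∉p∪q⁻ˡ (head∉ p))) p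

  vertices∉ : (p : Path B c v) → All (_∉ B) (trail p ++ v ∷ [])
  vertices∉ (done c∉B)    = c∉B ∷ []
  vertices∉ (via c∉B _ p) = c∉B ∷ All.map x∉p∪q⁻ˡ (vertices∉ p)

  trail-linked : Arc D x c → (p : Path B c v) → Linked (Arc D) (x ∷ trail p ++ v ∷ [])
  trail-linked xc (done _)    = xc ∷ [-]
  trail-linked xc (via _ t p) = xc ∷ trail-linked (child-arc t _) p

  trail-unique : x ∈ B → (p : Path B c v) → Unique (x ∷ trail p ++ v ∷ [])
  trail-unique x∈B p = All.map (λ v∉B x≡v → v∉B (subst (_∈ _) x≡v x∈B)) (vertices∉ p) ∷ rest p
    where
    rest : (p : Path B c v) → Unique (trail p ++ v ∷ [])
    rest (done _)    = [] ∷ []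
    rest (via _ _ p) = trail-unique (q⊆p∪q _ _ (x∈⁅x⁆ _)) p

  isPath : Arc D x c → x ∈ B → (p : Path B c v) → IsPath D x (trail p) v
  isPath xc x∈B p = trail-linked xc p , trail-unique x∈B p

  path? : ∀ B c → Decidable (Path B c)
  path? B = search B (⊃-wellFounded B)
    where
    search : ∀ B → Acc _⊃_ B → ∀ c v → Dec (Path B c v)
    search B (acc larger) c v with c ∈? B | c ≟ v
    ... | yes c∈B | _        = no (λ p → head∉ p c∈B)
    ... | no c∉B  | yes refl = yes (done c∉B)
    ... | no c∉B  | no c≢v
      with search _ (larger B⊂B∪⁅c⁆) (child true c) v | search _ (larger B⊂B∪⁅c⁆) (child false c) v
      where
      B⊂B∪⁅c⁆ : B ⊂ B ∪ ⁅ c ⁆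
      B⊂B∪⁅c⁆ = p⊆p∪q _ , c , q⊆p∪q _ _ (x∈⁅x⁆ c) , c∉B
    ... | yes p | _     = yes (via c∉B true p)
    ... | no _  | yes p = yes (via c∉B false p)
    ... | no ¬p | no ¬q = no λ { (done _) → c≢v refl ; (via _ true p) → ¬p p ; (via _ false q) → ¬q q }

  -- Abstract, so that B and c can be inferred from reach B c by unification.
  abstract
    reach : Subset n → Fin n → Subset n
    reach B c = ⟦ path? B c ⟧

    ∈reach⁺ : Path B c v → v ∈ reach B c
    ∈reach⁺ = ∈⟦⟧⁺ (path? _ _)

    ∈reach⁻ : v ∈ reach B c → Path B c v
    ∈reach⁻ = ∈⟦⟧⁻ (path? _ _)

  reach-step : v ∈ reach B c → ∀ t → child t v ∉ B → child t v ∈ reach B c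
  reach-step v∈ t w∉B = ∈reach⁺ (extend (∈reach⁻ v∈) t w∉B)

  reach-⊆ : ∀ {B B' c x} → c ∈ reach B' x → (∀ {v} → v ∈ reach B c → v ∉ B') → reach B c ⊆ reach B' x
  reach-⊆ {B} {B'} {c} {x} c∈ disjoint v∈ = proj₂ (Path-ind W closed (∈reach⁺ (done (head∉ p)) , c∈) p)
    where
    p = ∈reach⁻ v∈
    W : Pred (Fin n) _
    W v = v ∈ reach B c × v ∈ reach B' x
    closed : ∀ {u} t → W u → child t u ∉ B → W (child t u)
    closed t (u∈ , u∈') w∉B = let w∈ = reach-step u∈ t w∉B in w∈ , reach-step u∈' t (disjoint w∈)

  entering-arc : ∀ S → Path B c v → c ∉ S → v ∈ S →
                 ∃₂ λ u t → Path (B ∪ S) c u × child t u ∈ S × child t u ∉ B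
  entering-arc S (done _) c∉S c∈S = ⊥-elim (c∉S c∈S)
  entering-arc {B} {c} S (via c∉B t p) c∉S v∈S with child t c ∈? S
  ... | yes w∈S = c , t , done (x∉p∪q⁺ c∉B c∉S) , w∈S , x∉p∪q⁻ˡ (head∉ p)
  ... | no  w∉S with entering-arc S p w∉S v∈S
  ...   | u , t' , q , w'∈S , w'∉ =
    u , t' , via (x∉p∪q⁺ c∉B c∉S) t (weaken (⊆-reflexive reorder) q) , w'∈S , x∉p∪q⁻ˡ w'∉
    where
    reorder : (B ∪ S) ∪ ⁅ c ⁆ ≡ (B ∪ ⁅ c ⁆) ∪ S
    reorder = trans (∪-assoc B S ⁅ c ⁆) (trans (cong (B ∪_) (∪-comm S ⁅ c ⁆)) (sym (∪-assoc B ⁅ c ⁆ S)))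

  Region : Fin n → Bool → Subset n
  Region x s = reach ⁅ child s x ⁆ x

  self∈Region : x ∈ Region x s
  self∈Region {x} {s} = ∈reach⁺ (done (x≢y⇒x∉⁅y⁆ (≢-sym (child≢self s x))))

  other-child∈Region : child (not s) x ∈ Region x s
  other-child∈Region {s} {x} = reach-step self∈Region (not s) (x≢y⇒x∉⁅y⁆ (≢-sym (child≢sibling s x)))

  child∉Region : child s x ∉ Region x s
  child∉Region b∈ = last∉ (∈reach⁻ b∈) (x∈⁅x⁆ _)

  first-step∉Region : Path (⁅ child (not s) z ⁆ ∪ B) (child t z) v → child t z ∉ Region z s
  first-step∉Region {s} {z} {t = t} p with child-cases t s
  ... | inj₁ c≡b = subst (_∉ Region z s) (sym c≡b) child∉Region
  ... | inj₂ c≡a = ⊥-elim (head∉ p (p⊆p∪q _ (subst (_∈ ⁅ child (not s) z ⁆) (sym c≡a) (x∈⁅x⁆ _))))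

  other-child-region-⊆ : child s x ∉ Region (child (not s) x) s' → Region (child (not s) x) s' ⊆ Region x s
  other-child-region-⊆ b∉A = reach-⊆ other-child∈Region
    (λ v∈A v∈⁅b⁆ → b∉A (subst (_∈ _) (x∈⁅y⁆⇒x≡y _ v∈⁅b⁆) v∈A))

  -- The two z–w paths: z → a ⇝ w inside Region z s, and z → b ⇝ u → w with interior outside it.
  entering-arc⇒C22 : ∀ {s ρ t} → child ρ z ∉ Region z s → Path (B ∪ Region z s) (child ρ z) u →
                     child t u ∈ Region z s → child t u ≢ z → child t u ≢ child (not s) z →
                     ContainsSubdivision D C22
  entering-arc⇒C22 {z} {u = u} {s} {ρ} {t} b∉X b↝u w∈X w≢z w≢a with uncons (≢-sym w≢z) (∈reach⁻ w∈X)
  ... | ρ' , a↝w =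
    disjoint-paths⇒C22 (isPath (child-arc ρ' z) (q⊆p∪q _ _ (x∈⁅x⁆ z)) a↝w)
                       (isPath (child-arc ρ z) z∈X-w b↝w)
                       (trail≢[] a≢w a↝w) (trail≢[] b≢w b↝w) disjoint
    where
    X   = Region z s
    X-w = X ∩ ∁ ⁅ child t u ⁆

    z∈X-w : z ∈ X-w
    z∈X-w = x∈p∩q⁺ (self∈Region , x∉p⇒x∈∁p (x≢y⇒x∉⁅y⁆ (≢-sym w≢z)))

    w∉X-w : child t u ∉ X-w
    w∉X-w w∈X-w = x∈∁p⇒x∉p (proj₂ (x∈p∩q⁻ X _ w∈X-w)) (x∈⁅x⁆ _)

    b↝w : Path X-w (child ρ z) (child t u)
    b↝w = extend (weaken (q⊆p∪q _ _ ∘ p∩q⊆p _ _) b↝u) t w∉X-w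

    a≢w : child ρ' z ≢ child t u
    a≢w c≡w with child-cases ρ' s
    ... | inj₁ c≡b = head∉ a↝w (p⊆p∪q _ (subst (_∈ ⁅ child s z ⁆) (sym c≡b) (x∈⁅x⁆ _)))
    ... | inj₂ c≡a = w≢a (trans (sym c≡w) c≡a)

    b≢w : child ρ z ≢ child t u
    b≢w c≡w = b∉X (subst (_∈ X) (sym c≡w) w∈X)

    disjoint : ∀ {v} → v ∈ₗ trail a↝w → v ∉ₗ trail b↝w
    disjoint v∈a v∈b = trail-∉ b↝w v∈b (x∈p∩q⁺ (v∈X , x∉p⇒x∈∁p (x≢y⇒x∉⁅y⁆ (trail-≢ b↝w v∈b))))
      where
      v∈X = ∈reach⁺ (via (x≢y⇒x∉⁅y⁆ (≢-sym (child≢self s z))) ρ' (prefix a↝w v∈a))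

  common-region⇒C22 : ∀ s → y ≢ z → y ∈ Region z s → y ∈ Region z (not s) → ContainsSubdivision D C22
  common-region⇒C22 {y} {z} s y≢z y∈X y∈X' with uncons (≢-sym y≢z) (∈reach⁻ y∈X')
  ... | ρ , b↝y with entering-arc (Region z s) b↝y (first-step∉Region b↝y) y∈X
  ...   | u , t , b↝u , w∈X , w∉ =
    entering-arc⇒C22 (first-step∉Region b↝y) b↝u w∈X (x∉⁅y⁆⇒x≢y (x∉p∪q⁻ʳ w∉)) (x∉⁅y⁆⇒x≢y (x∉p∪q⁻ˡ w∉))

  region-through : child τ z ≡ c → Path S c u → z ∈ S → child (not τ) z ∈ S → ∀ t →
                   child t u ≢ z → child t u ≢ child (not τ) z → child t u ∈ Region z (not τ)
  region-through {τ} {z} refl p z∈S c∈S t w≢z w≢c =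
    ∈reach⁺ (via (x≢y⇒x∉⁅y⁆ (≢-sym (child≢self (not τ) z))) τ
              (extend (weaken (⁅x⁆∪⁅y⁆⊆p c∈S z∈S) p) t (x∉p∪q⁺ (x≢y⇒x∉⁅y⁆ w≢c) (x≢y⇒x∉⁅y⁆ w≢z))))

  module _ (v₀ : Fin n) where

    root : ∃[ r ] r ∈ₗ allFin n × (∀ {v} → v ∈ₗ allFin n → ∣ reach ∅ r ∣ ≤ ∣ reach ∅ v ∣)
    root = ∃-minimal-∈ (λ v → ∣ reach ∅ v ∣) (∈-allFin v₀)

    R : Subset n
    R = reach ∅ (proj₁ root)

    R-closed : v ∈ R → ∀ t → child t v ∈ R
    R-closed v∈R t = reach-step v∈R t ∉⊥

    R-strongly-connected : v ∈ R → y ∈ R → Path ∅ v y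
    R-strongly-connected v∈R y∈R =
      ∈reach⁻ (p⊆q∧∣q∣≤∣p∣⇒q⊆p (reach-⊆ v∈R (λ _ → ∉⊥)) (proj₂ (proj₂ root) (∈-allFin _)) y∈R)

    Minimal : Fin n → Bool → Set
    Minimal x s = x ∈ R × (∀ {y} t → y ∈ R → ∣ Region x s ∣ ≤ ∣ Region y t ∣)

    minimal-exists : ∃₂ Minimal
    minimal-exists =
      let (x , s) , m , min = ∃-minimal-∈ (λ (x , s) → ∣ Region x s ∣) (candidate (∈reach⁺ (done ∉⊥)) true)
          x∈R = proj₂ (∈-filter⁻ (_∈? R) {xs = allFin n} (proj₁ (∈-cartesianProduct⁻ _ bools m)))
      in  x , s , x∈R , λ t y∈R → min (candidate y∈R t)
      where
      bools : List Bool
      bools = true ∷ false ∷ []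
      ∈-bools : ∀ t → t ∈ₗ bools
      ∈-bools true  = here refl
      ∈-bools false = there (here refl)
      candidate : y ∈ R → ∀ t → (y , t) ∈ₗ cartesianProduct (filter (_∈? R) (allFin n)) bools
      candidate y∈R t = ∈-cartesianProduct⁺ (∈-filter⁺ (_∈? R) (∈-allFin _) y∈R) (∈-bools t)

    descend : Minimal x s → child s x ∉ Region (child (not s) x) s' →
              Minimal (child (not s) x) s' × x ∈ Region (child (not s) x) s' ×
              child s' (child (not s) x) ≡ child s x
    descend {x} {s} {s'} (x∈R , min) b∉A =
      (a∈R , λ t y∈R → ≤-trans (p⊆q⇒∣p∣≤∣q∣ A⊆X) (min t y∈R)) , x∈A , b-child-of-a
      where
      a   = child (not s) x
      a∈R = R-closed x∈R (not s)
      A⊆X = other-child-region-⊆ b∉A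

      x∈A : x ∈ Region a s'
      x∈A with x ∈? Region a s'
      ... | yes x∈A = x∈A
      ... | no  x∉A = ⊥-elim (<⇒≱ (p⊂q⇒∣p∣<∣q∣ (A⊆X , x , self∈Region , x∉A)) (min s' a∈R))

      b-child-of-a : child s' a ≡ child s x
      b-child-of-a with child s' a ≟ child s x
      ... | yes b≡ = b≡
      ... | no  b≢ = ⊥-elim (b∉A (reach-step x∈A s (x≢y⇒x∉⁅y⁆ (≢-sym b≢))))

    minimal-step : Minimal x s →
                   ContainsSubdivision D C22 ⊎
                   ∃[ s' ] Minimal (child (not s) x) s' × x ∈ Region (child (not s) x) s' ×
                           child s' (child (not s) x) ≡ child s x
    minimal-step {x} {s} M
      with child s x ∈? Region (child (not s) x) true | child s x ∈? Region (child (not s) x) false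
    ... | yes b∈₁ | yes b∈₂ = inj₁ (common-region⇒C22 true (child≢sibling s x) b∈₁ b∈₂)
    ... | no  b∉  | _       = inj₂ (true , descend M b∉)
    ... | yes _   | no  b∉  = inj₂ (false , descend M b∉)

    two-steps⇒C22 : ∀ {x s s₁ s₂} → let a = child (not s) x; b = child s x; a' = child (not s₁) a in
                    x ∈ R → x ∈ Region a s₁ → child s₁ a ≡ b → a ∈ Region a' s₂ → child s₂ a' ≡ b →
                    ContainsSubdivision D C22
    two-steps⇒C22 {x} {s} {s₁} {s₂} x∈R x∈A e₁ a∈A' e₂
      with entering-arc (Region x s) (R-strongly-connected (R-closed x∈R s) x∈R) child∉Region self∈Region
    ... | u , t , b↝u , w∈X , _ = close refl w∈X
      where
      a   = child (not s) x
      a'  = child (not s₁) a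
      a'' = child (not s₂) a'
      X   = Region x s

      a∈X : a ∈ X
      a∈X = other-child∈Region
      a'∈X : a' ∈ X
      a'∈X = reach-step a∈X (not s₁) (x≢y⇒x∉⁅y⁆ (λ a'≡b → child≢sibling s₁ a (trans e₁ (sym a'≡b))))
      a''∈X : a'' ∈ X
      a''∈X = reach-step a'∈X (not s₂) (x≢y⇒x∉⁅y⁆ (λ a''≡b → child≢sibling s₂ a' (trans e₂ (sym a''≡b))))

      through : ∀ {z w} τ → child t u ≡ w → child τ z ≡ child s x → z ∈ X → child (not τ) z ∈ X →
                w ≢ z → w ≢ child (not τ) z → w ∈ Region z (not τ)
      through τ refl e z∈X c∈X = region-through e b↝u (q⊆p∪q ∅ X z∈X) (q⊆p∪q ∅ X c∈X) t

      close : ∀ {w} → child t u ≡ w → w ∈ X → ContainsSubdivision D C22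
      close {w} arc w∈X with w ≟ x | w ≟ a
      ... | yes refl | _ = common-region⇒C22 s₁ x≢a x∈A (through s₁ arc e₁ a∈X a'∈X x≢a x≢a')
        where
        x≢a  = ≢-sym (child≢self (not s) x)
        x≢a' = ≢-sym (grandchild≢self (not s) (not s₁) x)
      ... | no _ | yes refl = common-region⇒C22 s₂ a≢a' a∈A' (through s₂ arc e₂ a'∈X a''∈X a≢a' a≢a'')
        where
        a≢a'  = ≢-sym (child≢self (not s₁) a)
        a≢a'' = ≢-sym (grandchild≢self (not s₁) (not s₂) a)
      ... | no w≢x | no w≢a =
        common-region⇒C22 s w≢x w∈X (through s arc refl self∈Region a∈X w≢x w≢a)

    C22-subdivision : ContainsSubdivision D C22
    C22-subdivision with minimal-exists
    ... | x , s , M with minimal-step M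
    ...   | inj₁ C22⊆D = C22⊆D
    ...   | inj₂ (s₁ , M₁ , x∈A , e₁) with minimal-step M₁
    ...     | inj₁ C22⊆D = C22⊆D
    ...     | inj₂ (s₂ , _ , a∈A' , e₂) = two-steps⇒C22 (proj₁ M) x∈A e₁ a∈A' (trans e₂ e₁)

theorem14 : (n : ℕ) (D : Digraph n) → Fin n → Oriented D →
            MinOutDegreeAtLeast 2 D → ContainsSubdivision D C22
theorem14 n D v₀ oriented δ⁺≥2 =
  TwoOut.C22-subdivision D oriented (λ t v → proj₁ (out v) t) (λ t v → proj₁ (proj₂ (out v)) t)
                         (λ v → proj₂ (proj₂ (out v))) v₀
  where
  out = λ v → two-out-neighbours {D = D} (δ⁺≥2 v)
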